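{- Let $P_n$ be the path graph on $n$ vertices, $k$ a positive integer, and $j$ an integer with $0\le j\le\lfloor n/2\rfloor$. Then $\lambda_j^k(P_n)=0$ if $k\ge 2$ or $n\le 3j+2$; and if $k=1$ and $n\ge 3j+3$, then $$\lambda_j^k(P_n)=\left\lfloor \frac{n-3j-1}{2}\right\rfloor.$$
   Context: Let $\lambda(G)$ denote the chromatic index of a simple graph $G$. For a positive integer $k$, a nonnegative integer $j$ and a graph $G=(V,E)$, a set $E'\subseteq E$ is a $k$-chromatic index $j$-mixed edge removal set if there exists $V'\subseteq V$ with $|V'|=j$ such that $\lambda(G-V'-E')\le k$, where $G-V'-E'$ is obtained by deleting the vertices of $V'$ (with incident edges) and the remaining edges of $E'$. The parameter $\lambda_j^k(G)$ is the minimum of $|E'|$ over all $k$-chromatic index $j$-mixed edge removal sets $E'$. -}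

module Defs where

open import Data.Nat using (ℕ; zero; suc; _+_; _≤_; _<ᵇ_; _≡ᵇ_)
open import Data.Bool using (Bool; true; false; _∧_; _∨_; not; if_then_else_)
open import Data.Fin using (Fin; toℕ)
open import Data.Fin.Subset using (Subset; ∣_∣)
open import Data.Vec using (lookup)
open import Data.List using (List; map; allFin)
open import Data.Nat.ListAction using (sum)
open import Data.Product using (Σ; _×_; ∃)
open import Relation.Binary.PropositionalEquality using (_≡_; _≢_)

Graph : ℕ → Set
Graph n = Fin n → Fin n → Bool

pathGraph : (n : ℕ) → Graph n
pathGraph n i j = (toℕ j ≡ᵇ suc (toℕ i)) ∨ (toℕ i ≡ᵇ suc (toℕ j))

edgeCount : {n : ℕ} → (Fin n → Fin n → Bool) → ℕ
edgeCount {n} s =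
  sum (map (λ i → sum (map (λ j → if (toℕ i <ᵇ toℕ j) ∧ s i j then 1 else 0)
                            (allFin n)))
           (allFin n))

IsEdgeSubset : {n : ℕ} → Graph n → (Fin n → Fin n → Bool) → Set
IsEdgeSubset {n} G E′ =
  (∀ i j → E′ i j ≡ E′ j i) × (∀ i j → E′ i j ≡ true → G i j ≡ true)

-- G - V' - E' : delete the vertices of V' (with incident edges) and the edges
-- of E'. Deleted vertices are kept as isolated vertices, which does not affect
-- the chromatic index.
deleteMixed : {n : ℕ} → Graph n → Subset n → (Fin n → Fin n → Bool) → Graph n
deleteMixed G V′ E′ i j =
  G i j ∧ not (lookup V′ i) ∧ not (lookup V′ j) ∧ not (E′ i j)

ChromaticIndexAtMost : {n : ℕ} → Graph n → ℕ → Set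
ChromaticIndexAtMost {n} H k =
  Σ (Fin n → Fin n → Fin k) λ c →
    (∀ i j → H i j ≡ true → c i j ≡ c j i) ×
    (∀ i j l → H i j ≡ true → H i l ≡ true → j ≢ l → c i j ≢ c i l)

IsMixedRemovalSet : {n : ℕ} → Graph n → (j k : ℕ) → (Fin n → Fin n → Bool) → Set
IsMixedRemovalSet G j k E′ =
  IsEdgeSubset G E′ ×
  ∃ λ V′ → (∣ V′ ∣ ≡ j) × ChromaticIndexAtMost (deleteMixed G V′ E′) k

MixedIndexIs : {n : ℕ} → Graph n → (j k m : ℕ) → Set
MixedIndexIs G j k m =
  (∃ λ E′ → IsMixedRemovalSet G j k E′ × edgeCount E′ ≡ m) ×
  (∀ E′ → IsMixedRemovalSet G j k E′ → m ≤ edgeCount E′)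

{-# OPTIONS --safe #-}
-- A graph has chromatic index at most 1 iff it is a matching; for what survives of the path
-- this means that among any three consecutive vertices u, v, w one is deleted or one of the
-- edges uv, vw is removed. Give a deleted vertex weight 3 and a removed edge {a, a + 1} weight 2,
-- placed at a. Every such window then carries weight at least 2 on its first two vertices or at
-- least 3 on all three, so scanning the path from the left gives n ≤ 2|E′| + 3j + 2, that is
-- |E′| ≥ ⌊(n − 3j − 1)/2⌋. Deleting the vertices 2, 5, …, 3q − 1 and every other edge beyond 3q
-- attains this with q = j; when n ≤ 3j + 2 already q = ⌊n/3⌋ leaves no edge to remove, and the
-- remaining j − q deleted vertices are arbitrary. With k ≥ 2 colours nothing has to be removed,
-- since colouring {a, a + 1} by the parity of a is proper on the whole path.

module Submission where

open import Defs
open import Data.Bool using (Bool; true; false; _∧_; not; if_then_else_)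
open import Data.Bool.Properties using (T-≡; ∧-zeroʳ; ∨-comm; not-¬)
open import Data.Empty using (⊥-elim)
open import Data.Fin as F using (Fin; toℕ; fromℕ<; opposite; inject≤)
open import Data.Fin.Properties using (toℕ-injective; toℕ-fromℕ<; inject≤-injective)
open import Data.Fin.Subset using (Subset; ∣_∣; _⊆_; ⊥)
open import Data.Fin.Subset.Properties using (s⊆s; out⊆; ⊆-refl; ∣p∣≤n; ∣⊥∣≡0)
open import Data.List using (map; allFin; tabulate)
open import Data.List.Properties using (map-tabulate)
open import Data.Nat
  using (ℕ; zero; suc; _+_; _*_; _∸_; _⊓_; _/_; _%_; _≤_; _<_; _<ᵇ_; _≡ᵇ_; _≤?_;
         z≤n; s≤s; s≤s⁻¹; z<s; s<s)
open import Data.Nat.DivMod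
  using (m/n≤m; m/n*n≤m; m<n*o⇒m/o<n; m<n⇒m/n≡0; m%n≡m∸m/n*n; m%n<n; m/n≡1+[m∸n]/n)
open import Data.Nat.ListAction using (sum)
open import Data.Nat.Properties
open import Data.Nat.Tactic.RingSolver using (solve-∀)
open import Data.Product using (∃; _×_; _,_; proj₁; proj₂)
open import Data.Sum using (_⊎_; inj₁; inj₂; [_,_]) renaming (map to map⊎)
open import Data.Vec using ([]; _∷_; lookup) renaming (tabulate to tabulateᵥ)
open import Data.Vec.Properties using (lookup∘tabulate; []=⇒lookup; lookup⇒[]=)
open import Function using (_∘_)
open import Function.Bundles using (Equivalence)
open import Relation.Nullary using (¬_; yes; no)
open import Relation.Binary.PropositionalEquality
  using (_≡_; _≢_; refl; sym; trans; cong; cong₂; subst; subst₂; module ≡-Reasoning)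
open ≡-Reasoning

∑ : ℕ → (ℕ → ℕ) → ℕ
∑ zero    f = 0
∑ (suc n) f = f 0 + ∑ n (f ∘ suc)

∑-cong : ∀ n {f g : ℕ → ℕ} → (∀ a → a < n → f a ≡ g a) → ∑ n f ≡ ∑ n g
∑-cong zero    f≗g = refl
∑-cong (suc n) f≗g = cong₂ _+_ (f≗g 0 z<s) (∑-cong n (λ a a<n → f≗g (suc a) (s<s a<n)))

∑-zero : ∀ n {f : ℕ → ℕ} → (∀ a → a < n → f a ≡ 0) → ∑ n f ≡ 0
∑-zero zero    f≗0 = refl
∑-zero (suc n) f≗0 = cong₂ _+_ (f≗0 0 z<s) (∑-zero n (λ a a<n → f≗0 (suc a) (s<s a<n)))

∑-snoc : ∀ n (f : ℕ → ℕ) → ∑ (suc n) f ≡ ∑ n f + f n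
∑-snoc zero    f = +-identityʳ (f 0)
∑-snoc (suc n) f = trans (cong (f 0 +_) (∑-snoc n (f ∘ suc))) (sym (+-assoc (f 0) _ _))

∑-single : ∀ n (f : ℕ → ℕ) t → (∀ a → a ≢ t → f a ≡ 0) → (∀ a → n ≤ a → f a ≡ 0) →
           ∑ n f ≡ f t
∑-single zero    f t       off-t beyond = sym (beyond t z≤n)
∑-single (suc n) f zero    off-t beyond =
  trans (cong (f 0 +_) (∑-zero n (λ a _ → off-t (suc a) (λ ())))) (+-identityʳ (f 0))
∑-single (suc n) f (suc t) off-t beyond rewrite off-t 0 (λ ()) =
  ∑-single n (f ∘ suc) t (λ a a≢t → off-t (suc a) (a≢t ∘ suc-injective))
                          (λ a n≤a → beyond (suc a) (s≤s n≤a))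

∑-+ : ∀ n (f g : ℕ → ℕ) → ∑ n (λ a → f a + g a) ≡ ∑ n f + ∑ n g
∑-+ zero    f g = refl
∑-+ (suc n) f g = trans (cong (f 0 + g 0 +_) (∑-+ n (f ∘ suc) (g ∘ suc)))
                        (interchange (f 0) (g 0) (∑ n (f ∘ suc)) (∑ n (g ∘ suc)))
  where
  interchange : ∀ w x y z → w + x + (y + z) ≡ w + y + (x + z)
  interchange = solve-∀

∑-* : ∀ n k (f : ℕ → ℕ) → ∑ n (λ a → k * f a) ≡ k * ∑ n f
∑-* zero    k f = sym (*-zeroʳ k)
∑-* (suc n) k f = trans (cong (k * f 0 +_) (∑-* n k (f ∘ suc))) (sym (*-distribˡ-+ k (f 0) _))

sum-allFin : ∀ n (g : Fin n → ℕ) (f : ℕ → ℕ) → (∀ x → g x ≡ f (toℕ x)) →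
             sum (map g (allFin n)) ≡ ∑ n f
sum-allFin n g f g≗f = trans (cong sum (map-tabulate (λ x → x) g)) (sum-tabulate n g f g≗f)
  where
  sum-tabulate : ∀ n (g : Fin n → ℕ) (f : ℕ → ℕ) → (∀ x → g x ≡ f (toℕ x)) →
                 sum (tabulate g) ≡ ∑ n f
  sum-tabulate zero    g f g≗f = refl
  sum-tabulate (suc n) g f g≗f =
    cong₂ _+_ (g≗f F.zero) (sum-tabulate n (g ∘ F.suc) (f ∘ suc) (g≗f ∘ F.suc))

𝟙 : Bool → ℕ
𝟙 b = if b then 1 else 0

atℕ : ∀ {n} → (Fin n → Bool) → ℕ → Bool
atℕ {zero}  f a       = false
atℕ {suc n} f zero    = f F.zero
atℕ {suc n} f (suc a) = atℕ (f ∘ F.suc) a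

atℕ-toℕ : ∀ {n} (f : Fin n → Bool) x → atℕ f (toℕ x) ≡ f x
atℕ-toℕ f F.zero    = refl
atℕ-toℕ f (F.suc x) = atℕ-toℕ (f ∘ F.suc) x

atℕ-≥ : ∀ {n} (f : Fin n → Bool) {a} → n ≤ a → atℕ f a ≡ false
atℕ-≥ {zero}  f n≤a       = refl
atℕ-≥ {suc n} f (s≤s n≤a) = atℕ-≥ (f ∘ F.suc) n≤a

atℕ-false : ∀ {n} {f : Fin n → Bool} → (∀ x → f x ≡ false) → ∀ a → atℕ f a ≡ false
atℕ-false {zero}  f≗false a       = refl
atℕ-false {suc n} f≗false zero    = f≗false F.zero
atℕ-false {suc n} f≗false (suc a) = atℕ-false (f≗false ∘ F.suc) a

atℕ-true : ∀ {n} (f : Fin n → Bool) a → atℕ f a ≡ true → ∃ λ x → toℕ x ≡ a × f x ≡ true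
atℕ-true {suc n} f zero    fa = F.zero , refl , fa
atℕ-true {suc n} f (suc a) fa with atℕ-true (f ∘ F.suc) a fa
... | x , x≡a , fx = F.suc x , cong suc x≡a , fx

∣V∣≡∑ : ∀ {n} (V : Subset n) → ∣ V ∣ ≡ ∑ n (𝟙 ∘ atℕ (lookup V))
∣V∣≡∑ []          = refl
∣V∣≡∑ (true ∷ V)  = cong suc (∣V∣≡∑ V)
∣V∣≡∑ (false ∷ V) = ∣V∣≡∑ V

∣tabulate∣≡∑ : ∀ n (f : ℕ → Bool) → ∣ tabulateᵥ {n = n} (f ∘ toℕ) ∣ ≡ ∑ n (𝟙 ∘ f)
∣tabulate∣≡∑ zero    f = refl
∣tabulate∣≡∑ (suc n) f with f 0
... | true  = cong suc (∣tabulate∣≡∑ n (f ∘ suc))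
... | false = ∣tabulate∣≡∑ n (f ∘ suc)

extendSubset : ∀ {n j} (p : Subset n) → ∣ p ∣ ≤ j → j ≤ n → ∃ λ q → p ⊆ q × ∣ q ∣ ≡ j
extendSubset {zero}  {zero}  []          _         _         = [] , ⊆-refl , refl
extendSubset {suc n} {suc j} (true ∷ p)  (s≤s p≤j) (s≤s j≤n) with extendSubset p p≤j j≤n
... | q , p⊆q , ∣q∣≡j = true ∷ q , s⊆s p⊆q , cong suc ∣q∣≡j
extendSubset {suc n} {j}     (false ∷ p) p≤j       j≤1+n     with j ≤? n
... | yes j≤n with extendSubset p p≤j j≤n
...   | q , p⊆q , ∣q∣≡j = false ∷ q , s⊆s p⊆q , ∣q∣≡j
extendSubset {suc n} {j}     (false ∷ p) p≤j       j≤1+n     | no j≰n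
  with extendSubset p (∣p∣≤n p) ≤-refl
... | q , p⊆q , ∣q∣≡n = true ∷ q , out⊆ p⊆q , trans (cong suc ∣q∣≡n) (≤-antisym (≰⇒> j≰n) j≤1+n)

Consecutive : ∀ {n} → Fin n → Fin n → Set
Consecutive u v = toℕ v ≡ suc (toℕ u)

successor-unique : ∀ {n} {u v w : Fin n} → Consecutive u v → Consecutive u w → v ≡ w
successor-unique uv uw = toℕ-injective (trans uv (sym uw))

predecessor-unique : ∀ {n} {u v w : Fin n} → Consecutive u w → Consecutive v w → u ≡ v
predecessor-unique uw vw = toℕ-injective (suc-injective (trans (sym uw) vw))

consecutive-⊓ : ∀ {n} {u v : Fin n} → Consecutive u v → toℕ u ⊓ toℕ v ≡ toℕ u
consecutive-⊓ {u = u} u→v = m≤n⇒m⊓n≡m (≤-trans (n≤1+n (toℕ u)) (≤-reflexive (sym u→v)))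

pathGraph-sym : ∀ {n} (x y : Fin n) → pathGraph n x y ≡ pathGraph n y x
pathGraph-sym x y = ∨-comm (toℕ y ≡ᵇ suc (toℕ x)) (toℕ x ≡ᵇ suc (toℕ y))

consecutive⇒pathGraph : ∀ {n} {x y : Fin n} → Consecutive x y → pathGraph n x y ≡ true
consecutive⇒pathGraph {x = x} {y} xy
  rewrite Equivalence.to T-≡ (≡⇒≡ᵇ (toℕ y) (suc (toℕ x)) xy) = refl

pathGraph⇒consecutive : ∀ {n} {x y : Fin n} → pathGraph n x y ≡ true →
                        Consecutive x y ⊎ Consecutive y x
pathGraph⇒consecutive {x = x} {y} xy with toℕ y ≡ᵇ suc (toℕ x) in y≡1+x
... | true  = inj₁ (≡ᵇ⇒≡ _ _ (Equivalence.from T-≡ y≡1+x))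
... | false = inj₂ (≡ᵇ⇒≡ _ _ (Equivalence.from T-≡ xy))

pathGraph-< : ∀ {n} {x y : Fin n} → pathGraph n x y ≡ true → toℕ x < toℕ y → Consecutive x y
pathGraph-< xy x<y with pathGraph⇒consecutive xy
... | inj₁ x→y = x→y
... | inj₂ y→x = ⊥-elim (<-asym x<y (≤-reflexive (sym y→x)))

distinct-neighbours : ∀ {n} {i j l : Fin n} → pathGraph n i j ≡ true → pathGraph n i l ≡ true →
  j ≢ l → (Consecutive j i × Consecutive i l) ⊎ (Consecutive l i × Consecutive i j)
distinct-neighbours ij il j≢l with pathGraph⇒consecutive ij | pathGraph⇒consecutive il
... | inj₁ i→j | inj₁ i→l = ⊥-elim (j≢l (successor-unique i→j i→l))
... | inj₂ j→i | inj₂ l→i = ⊥-elim (j≢l (predecessor-unique j→i l→i))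
... | inj₂ j→i | inj₁ i→l = inj₁ (j→i , i→l)
... | inj₁ i→j | inj₂ l→i = inj₂ (l→i , i→j)

edgeAt : ∀ {n} → (Fin n → Fin n → Bool) → ℕ → Bool
edgeAt E a = atℕ (λ x → atℕ (E x) (suc a)) a

edgeAt-consecutive : ∀ {n} (E : Fin n → Fin n → Bool) {u v} → Consecutive u v →
                     edgeAt E (toℕ u) ≡ E u v
edgeAt-consecutive E {u} {v} uv = begin
  atℕ (λ x → atℕ (E x) (suc (toℕ u))) (toℕ u) ≡⟨ atℕ-toℕ _ u ⟩
  atℕ (E u) (suc (toℕ u))                     ≡⟨ cong (atℕ (E u)) (sym uv) ⟩
  atℕ (E u) (toℕ v)                           ≡⟨ atℕ-toℕ (E u) v ⟩
  E u v                                       ∎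

edgeCount≡∑edgeAt : ∀ {n} (E : Fin n → Fin n → Bool) →
  (∀ i j → E i j ≡ true → pathGraph n i j ≡ true) → edgeCount E ≡ ∑ n (𝟙 ∘ edgeAt E)
edgeCount≡∑edgeAt {n} E E⊆P = sum-allFin n _ _ row
  where
  above : Fin n → ℕ → ℕ
  above x b = 𝟙 ((toℕ x <ᵇ b) ∧ atℕ (E x) b)

  above-only : ∀ x b → b ≢ suc (toℕ x) → above x b ≡ 0
  above-only x b b≢1+x with toℕ x <ᵇ b in x<b | atℕ (E x) b in Exb
  ... | false | _     = refl
  ... | true  | false = refl
  ... | true  | true  with atℕ-true (E x) b Exb
  ... | y , refl , Exy =
    ⊥-elim (b≢1+x (pathGraph-< (E⊆P x y Exy) (<ᵇ⇒< _ _ (Equivalence.from T-≡ x<b))))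

  above-≥ : ∀ x b → n ≤ b → above x b ≡ 0
  above-≥ x b n≤b rewrite atℕ-≥ (E x) n≤b | ∧-zeroʳ (toℕ x <ᵇ b) = refl

  row : ∀ x → sum (map (λ y → 𝟙 ((toℕ x <ᵇ toℕ y) ∧ E x y)) (allFin n)) ≡
              𝟙 (edgeAt E (toℕ x))
  row x = begin
    sum (map (λ y → 𝟙 ((toℕ x <ᵇ toℕ y) ∧ E x y)) (allFin n))
      ≡⟨ sum-allFin n _ (above x)
           (λ y → cong (λ b → 𝟙 ((toℕ x <ᵇ toℕ y) ∧ b)) (sym (atℕ-toℕ (E x) y))) ⟩
    ∑ n (above x)
      ≡⟨ ∑-single n (above x) (suc (toℕ x)) (above-only x) (above-≥ x) ⟩
    𝟙 ((toℕ x <ᵇ suc (toℕ x)) ∧ atℕ (E x) (suc (toℕ x)))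
      ≡⟨ cong (λ b → 𝟙 (b ∧ atℕ (E x) (suc (toℕ x))))
              (Equivalence.to T-≡ (<⇒<ᵇ (n<1+n (toℕ x)))) ⟩
    𝟙 (atℕ (E x) (suc (toℕ x)))
      ≡⟨ cong 𝟙 (sym (atℕ-toℕ (λ z → atℕ (E z) (suc (toℕ x))) x)) ⟩
    𝟙 (edgeAt E (toℕ x))
      ∎

-- Edge colourings and matchings

colouring-mono : ∀ {n} {H : Graph n} {k k′} → k ≤ k′ →
  ChromaticIndexAtMost H k → ChromaticIndexAtMost H k′
colouring-mono k≤k′ (c , c-sym , c-proper) =
  (λ i j → inject≤ (c i j) k≤k′) ,
  (λ i j ij → cong (λ a → inject≤ a k≤k′) (c-sym i j ij)) ,
  (λ i j l ij il j≢l → c-proper i j l ij il j≢l ∘ inject≤-injective k≤k′ k≤k′ (c i j) (c i l))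

colouring-⊆ : ∀ {n} {G H : Graph n} {k} → (∀ i j → H i j ≡ true → G i j ≡ true) →
  ChromaticIndexAtMost G k → ChromaticIndexAtMost H k
colouring-⊆ H⊆G (c , c-sym , c-proper) =
  c , (λ i j ij → c-sym i j (H⊆G i j ij)) ,
  (λ i j l ij il → c-proper i j l (H⊆G i j ij) (H⊆G i l il))

IsMatching : ∀ {n} → Graph n → Set
IsMatching {n} H = ∀ (i j l : Fin n) → H i j ≡ true → H i l ≡ true → j ≡ l

matching⇒1-colourable : ∀ {n} {H : Graph n} → IsMatching H → ChromaticIndexAtMost H 1
matching⇒1-colourable M =
  (λ _ _ → F.zero) , (λ _ _ _ → refl) , (λ i j l ij il j≢l _ → j≢l (M i j l ij il))

1-colourable⇒matching : ∀ {n} {H : Graph n} → ChromaticIndexAtMost H 1 → IsMatching H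
1-colourable⇒matching (c , _ , c-proper) i j l ij il with j F.≟ l
... | yes j≡l = j≡l
... | no  j≢l = ⊥-elim (c-proper i j l ij il j≢l (Fin1-unique (c i j) (c i l)))
  where
  Fin1-unique : (x y : Fin 1) → x ≡ y
  Fin1-unique F.zero F.zero = refl

alternating : ℕ → Fin 2
alternating zero    = F.zero
alternating (suc a) = opposite (alternating a)

alternating-suc : ∀ a → alternating (suc a) ≢ alternating a
alternating-suc a with alternating a
... | F.zero          = λ ()
... | F.suc F.zero    = λ ()

pathGraph-2-colourable : ∀ n → ChromaticIndexAtMost (pathGraph n) 2
pathGraph-2-colourable n = colour , colour-sym , colour-proper
  where
  colour : Fin n → Fin n → Fin 2
  colour i j = alternating (toℕ i ⊓ toℕ j)

  colour-sym : ∀ i j → pathGraph n i j ≡ true → colour i j ≡ colour j i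
  colour-sym i j _ = cong alternating (⊓-comm (toℕ i) (toℕ j))

  colour-consecutive : ∀ {u v} → Consecutive u v → colour u v ≡ alternating (toℕ u)
  colour-consecutive = cong alternating ∘ consecutive-⊓

  colour-proper : ∀ i j l → pathGraph n i j ≡ true → pathGraph n i l ≡ true → j ≢ l →
                  colour i j ≢ colour i l
  colour-proper i j l ij il j≢l with distinct-neighbours ij il j≢l
  ... | inj₁ (j→i , i→l) = λ same → alternating-suc (toℕ j) (sym (begin
    alternating (toℕ j)         ≡⟨ colour-consecutive j→i ⟨
    colour j i                  ≡⟨ colour-sym j i (consecutive⇒pathGraph j→i) ⟩
    colour i j                  ≡⟨ same ⟩
    colour i l                  ≡⟨ colour-consecutive i→l ⟩
    alternating (toℕ i)         ≡⟨ cong alternating j→i ⟩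
    alternating (suc (toℕ j))   ∎))
  ... | inj₂ (l→i , i→j) = λ same → alternating-suc (toℕ l) (begin
    alternating (suc (toℕ l))   ≡⟨ cong alternating l→i ⟨
    alternating (toℕ i)         ≡⟨ colour-consecutive i→j ⟨
    colour i j                  ≡⟨ same ⟩
    colour i l                  ≡⟨ colour-sym l i (consecutive⇒pathGraph l→i) ⟨
    colour l i                  ≡⟨ colour-consecutive l→i ⟩
    alternating (toℕ l)         ∎)

deleteMixed-intro : ∀ {n} {G : Graph n} {V E i j} → G i j ≡ true → lookup V i ≡ false →
  lookup V j ≡ false → E i j ≡ false → deleteMixed G V E i j ≡ true
deleteMixed-intro Gij Vi Vj Eij rewrite Gij | Vi | Vj | Eij = refl

deleteMixed-elim : ∀ {n} {G : Graph n} {V E i j} → deleteMixed G V E i j ≡ true →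
  G i j ≡ true × lookup V i ≡ false × lookup V j ≡ false × E i j ≡ false
deleteMixed-elim {G = G} {V} {E} {i} {j} kept = go (G i j) (lookup V i) (lookup V j) (E i j) kept
  where
  go : ∀ g a b e → (g ∧ not a ∧ not b ∧ not e) ≡ true → g ≡ true × a ≡ false × b ≡ false × e ≡ false
  go true false false false refl = refl , refl , refl , refl
  go false a     b     e     ()
  go true  true  b     e     ()
  go true  false true  e     ()
  go true  false false true  ()

deleteMixed-⊆ : ∀ {n} (G : Graph n) V E i j → deleteMixed G V E i j ≡ true → G i j ≡ true
deleteMixed-⊆ G V E i j = proj₁ ∘ deleteMixed-elim {G = G} {V} {E}

Blocked : ∀ {n} → Subset n → (Fin n → Fin n → Bool) → Fin n → Fin n → Fin n → Set
Blocked V E u v w =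
  lookup V u ≡ true ⊎ lookup V v ≡ true ⊎ lookup V w ≡ true ⊎ E u v ≡ true ⊎ E v w ≡ true

BlocksAllP₃ : ∀ {n} → Subset n → (Fin n → Fin n → Bool) → Set
BlocksAllP₃ V E = ∀ u v w → Consecutive u v → Consecutive v w → Blocked V E u v w

matching⇒blocksAllP₃ : ∀ {n} {V : Subset n} {E} → (∀ i j → E i j ≡ E j i) →
  IsMatching (deleteMixed (pathGraph n) V E) → BlocksAllP₃ V E
matching⇒blocksAllP₃ {n} {V} {E} E-sym M u v w u→v v→w
  with lookup V u in Vu | lookup V v in Vv | lookup V w in Vw | E u v in Euv | E v w in Evw
... | true  | _     | _     | _     | _     = inj₁ refl
... | false | true  | _     | _     | _     = inj₂ (inj₁ refl)
... | false | false | true  | _     | _     = inj₂ (inj₂ (inj₁ refl))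
... | false | false | false | true  | _     = inj₂ (inj₂ (inj₂ (inj₁ refl)))
... | false | false | false | false | true  = inj₂ (inj₂ (inj₂ (inj₂ refl)))
... | false | false | false | false | false = ⊥-elim (u≢w (M v u w vu-kept vw-kept))
  where
  vu-kept : deleteMixed (pathGraph n) V E v u ≡ true
  vu-kept = deleteMixed-intro {G = pathGraph n} {V} {E}
    (trans (pathGraph-sym v u) (consecutive⇒pathGraph u→v)) Vv Vu (trans (E-sym v u) Euv)
  vw-kept : deleteMixed (pathGraph n) V E v w ≡ true
  vw-kept = deleteMixed-intro {G = pathGraph n} {V} {E} (consecutive⇒pathGraph v→w) Vv Vw Evw
  u≢w : u ≢ w
  u≢w = <⇒≢ (<-trans (≤-reflexive (sym u→v)) (≤-reflexive (sym v→w))) ∘ cong toℕ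

¬Blocked : ∀ {n} {V : Subset n} {E u v w} → lookup V u ≡ false → lookup V v ≡ false →
  lookup V w ≡ false → E u v ≡ false → E v w ≡ false → ¬ Blocked V E u v w
¬Blocked Vu _  _  _   _   (inj₁ Vu′)                        = not-¬ Vu Vu′
¬Blocked _  Vv _  _   _   (inj₂ (inj₁ Vv′))                 = not-¬ Vv Vv′
¬Blocked _  _  Vw _   _   (inj₂ (inj₂ (inj₁ Vw′)))          = not-¬ Vw Vw′
¬Blocked _  _  _  Euv _   (inj₂ (inj₂ (inj₂ (inj₁ Euv′))))  = not-¬ Euv Euv′
¬Blocked _  _  _  _   Evw (inj₂ (inj₂ (inj₂ (inj₂ Evw′))))  = not-¬ Evw Evw′

blocksAllP₃⇒matching : ∀ {n} {V : Subset n} {E} → (∀ i j → E i j ≡ E j i) →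
  BlocksAllP₃ V E → IsMatching (deleteMixed (pathGraph n) V E)
blocksAllP₃⇒matching {n} {V} {E} E-sym B i j l ij il with j F.≟ l
... | yes j≡l = j≡l
... | no  j≢l
  with deleteMixed-elim {G = pathGraph n} {V} {E} ij | deleteMixed-elim {G = pathGraph n} {V} {E} il
... | Pij , Vi , Vj , Eij | Pil , _ , Vl , Eil with distinct-neighbours Pij Pil j≢l
...   | inj₁ (j→i , i→l) =
  ⊥-elim (¬Blocked {V = V} {E} Vj Vi Vl (trans (E-sym j i) Eij) Eil (B j i l j→i i→l))
...   | inj₂ (l→i , i→j) =
  ⊥-elim (¬Blocked {V = V} {E} Vl Vi Vj (trans (E-sym l i) Eil) Eij (B l i j l→i i→j))

-- The lower bound

HeavyWindow : (ℕ → ℕ) → ℕ → Set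
HeavyWindow c a = 2 ≤ c a + c (suc a) ⊎ 3 ≤ c a + c (suc a) + c (suc (suc a))

+-mono-≤-reassoc : ∀ {w x y z t} → w ≤ y → x ≤ z + t → w + x ≤ y + z + t
+-mono-≤-reassoc {y = y} {z} {t} w≤y x≤z+t =
  ≤-trans (+-mono-≤ w≤y x≤z+t) (≤-reflexive (sym (+-assoc y z t)))

≤∑+2 : ∀ n (c : ℕ → ℕ) → (∀ a → suc (suc a) < n → HeavyWindow c a) → n ≤ ∑ n c + 2
≤∑+2 zero                c _ = z≤n
≤∑+2 (suc zero)          c _ = ≤-trans (s≤s z≤n) (m≤n+m 2 (∑ 1 c))
≤∑+2 (suc (suc zero))    c _ = m≤n+m 2 (∑ 2 c)
≤∑+2 (suc (suc (suc m))) c heavy =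
  [ pair-step (≤∑+2 (suc m) (c ∘ suc ∘ suc) (λ a → heavy (2 + a) ∘ s≤s ∘ s≤s))
  , triple-step (≤∑+2 m (c ∘ suc ∘ suc ∘ suc) (λ a → heavy (3 + a) ∘ s≤s ∘ s≤s ∘ s≤s))
  ] (heavy 0 (s≤s (s≤s (s≤s z≤n))))
  where
  pair-step : suc m ≤ ∑ (suc m) (c ∘ suc ∘ suc) + 2 → 2 ≤ c 0 + c 1 → 3 + m ≤ ∑ (3 + m) c + 2
  pair-step ih pair = ≤-trans (+-mono-≤-reassoc pair ih)
                              (≤-reflexive (cong (_+ 2) (+-assoc (c 0) (c 1) _)))
  triple-step : m ≤ ∑ m (c ∘ suc ∘ suc ∘ suc) + 2 → 3 ≤ c 0 + c 1 + c 2 → 3 + m ≤ ∑ (3 + m) c + 2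
  triple-step ih triple = ≤-trans (+-mono-≤-reassoc triple ih)
    (≤-reflexive (cong (_+ 2) (trans (+-assoc (c 0 + c 1) (c 2) _) (+-assoc (c 0) (c 1) _))))

fromℕ<-consecutive : ∀ {n a} (a<n : a < n) (1+a<n : suc a < n) →
                     Consecutive (fromℕ< a<n) (fromℕ< 1+a<n)
fromℕ<-consecutive a<n 1+a<n = trans (toℕ-fromℕ< 1+a<n) (cong suc (sym (toℕ-fromℕ< a<n)))

weight : ∀ {n} → Subset n → (Fin n → Fin n → Bool) → ℕ → ℕ
weight V E a = 2 * 𝟙 (edgeAt E a) + 3 * 𝟙 (atℕ (lookup V) a)

weight-vertex : ∀ {n} {V : Subset n} E {x} → lookup V x ≡ true → 3 ≤ weight V E (toℕ x)
weight-vertex {V = V} E {x} Vx rewrite atℕ-toℕ (lookup V) x | Vx = m≤n+m 3 _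

weight-edge : ∀ {n} (V : Subset n) {E x y} → Consecutive x y → E x y ≡ true →
              2 ≤ weight V E (toℕ x)
weight-edge V {E} x→y Exy rewrite edgeAt-consecutive E x→y | Exy = m≤m+n 2 _

heavyWindow : ∀ {n} {V : Subset n} {E u v w} → BlocksAllP₃ V E →
  Consecutive u v → Consecutive v w → HeavyWindow (weight V E) (toℕ u)
heavyWindow {V = V} {E} {u} {v} {w} blocks u→v v→w =
  subst₂ (λ b b′ → 2 ≤ c (toℕ u) + c b ⊎ 3 ≤ c (toℕ u) + c b + c b′)
         u→v (trans v→w (cong suc u→v)) (heavy (blocks u v w u→v v→w))
  where
  c : ℕ → ℕ
  c = weight V E
  heavy : Blocked V E u v w →
          2 ≤ c (toℕ u) + c (toℕ v) ⊎ 3 ≤ c (toℕ u) + c (toℕ v) + c (toℕ w)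
  heavy (inj₁ Vu)                       =
    inj₂ (m≤n⇒m≤n+o (c (toℕ w)) (m≤n⇒m≤n+o (c (toℕ v)) (weight-vertex {V = V} E Vu)))
  heavy (inj₂ (inj₁ Vv))                =
    inj₂ (m≤n⇒m≤n+o (c (toℕ w)) (m≤n⇒m≤o+n (c (toℕ u)) (weight-vertex {V = V} E Vv)))
  heavy (inj₂ (inj₂ (inj₁ Vw)))         =
    inj₂ (m≤n⇒m≤o+n (c (toℕ u) + c (toℕ v)) (weight-vertex {V = V} E Vw))
  heavy (inj₂ (inj₂ (inj₂ (inj₁ Euv)))) = inj₁ (m≤n⇒m≤n+o (c (toℕ v)) (weight-edge V {E} u→v Euv))
  heavy (inj₂ (inj₂ (inj₂ (inj₂ Evw)))) = inj₁ (m≤n⇒m≤o+n (c (toℕ u)) (weight-edge V {E} v→w Evw))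

∑-weight : ∀ {n} (V : Subset n) {E} → (∀ i j → E i j ≡ true → pathGraph n i j ≡ true) →
          ∑ n (weight V E) ≡ 2 * edgeCount E + 3 * ∣ V ∣
∑-weight {n} V {E} E⊆P = begin
  ∑ n (weight V E)
    ≡⟨ ∑-+ n _ _ ⟩
  ∑ n (λ a → 2 * 𝟙 (edgeAt E a)) + ∑ n (λ a → 3 * 𝟙 (atℕ (lookup V) a))
    ≡⟨ cong₂ _+_ (∑-* n 2 _) (∑-* n 3 _) ⟩
  2 * ∑ n (𝟙 ∘ edgeAt E) + 3 * ∑ n (𝟙 ∘ atℕ (lookup V))
    ≡⟨ cong₂ (λ e v → 2 * e + 3 * v) (sym (edgeCount≡∑edgeAt E E⊆P)) (sym (∣V∣≡∑ V)) ⟩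
  2 * edgeCount E + 3 * ∣ V ∣
    ∎

n≤2m+J+2⇒[n∸J∸1]/2≤m : ∀ {n m} J → n ≤ 2 * m + J + 2 → (n ∸ J ∸ 1) / 2 ≤ m
n≤2m+J+2⇒[n∸J∸1]/2≤m {n} {m} J n≤ =
  s≤s⁻¹ (m<n*o⇒m/o<n (≤-trans (s≤s (∸-monoˡ-≤ 1 n∸J≤)) (≤-reflexive 2+2m≡1+m*2)))
  where
  reorder : ∀ m J → 2 * m + J + 2 ≡ suc (suc (2 * m)) + J
  reorder = solve-∀
  n∸J≤ : n ∸ J ≤ suc (suc (2 * m))
  n∸J≤ = subst (n ∸ J ≤_) (m+n∸n≡m _ J) (∸-monoˡ-≤ J (≤-trans n≤ (≤-reflexive (reorder m J))))
  2+2m≡1+m*2 : suc (suc (2 * m)) ≡ suc m * 2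
  2+2m≡1+m*2 = cong (suc ∘ suc) (*-comm 2 m)

removalSet-lowerBound : ∀ {n j E} → IsMixedRemovalSet (pathGraph n) j 1 E →
                        (n ∸ 3 * j ∸ 1) / 2 ≤ edgeCount E
removalSet-lowerBound {n} {j} {E} ((E-sym , E⊆P) , V , ∣V∣≡j , colouring) =
  n≤2m+J+2⇒[n∸J∸1]/2≤m (3 * j) (subst (λ t → n ≤ t + 2) ∑-weight≡ (≤∑+2 n (weight V E) heavy))
  where
  blocks : BlocksAllP₃ V E
  blocks = matching⇒blocksAllP₃ {V = V} E-sym (1-colourable⇒matching colouring)
  heavy : ∀ a → suc (suc a) < n → HeavyWindow (weight V E) a
  heavy a 2+a<n = subst (HeavyWindow (weight V E)) (toℕ-fromℕ< a<n)
    (heavyWindow {V = V} {E} blocks (fromℕ<-consecutive a<n 1+a<n)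
                                    (fromℕ<-consecutive 1+a<n 2+a<n))
    where
    1+a<n : suc a < n
    1+a<n = <-trans (n<1+n _) 2+a<n
    a<n : a < n
    a<n = <-trans (n<1+n _) 1+a<n
  ∑-weight≡ : ∑ n (weight V E) ≡ 2 * edgeCount E + 3 * j
  ∑-weight≡ = trans (∑-weight V E⊆P) (cong (λ s → 2 * edgeCount E + 3 * s) ∣V∣≡j)

-- vertexPattern q marks the vertices 2, 5, …, 3q − 1, and edgePattern q marks the edges
-- {a, a + 1} with a ≥ 3q and a − 3q odd.
vertexPattern : ℕ → ℕ → Bool
vertexPattern zero    a                   = false
vertexPattern (suc q) zero                = false
vertexPattern (suc q) (suc zero)          = false
vertexPattern (suc q) (suc (suc zero))    = true
vertexPattern (suc q) (suc (suc (suc a))) = vertexPattern q a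

edgePattern : ℕ → ℕ → Bool
edgePattern zero    zero                = false
edgePattern zero    (suc zero)          = true
edgePattern zero    (suc (suc a))       = edgePattern zero a
edgePattern (suc q) zero                = false
edgePattern (suc q) (suc zero)          = false
edgePattern (suc q) (suc (suc zero))    = false
edgePattern (suc q) (suc (suc (suc a))) = edgePattern q a

patterns-block : ∀ q a →
  vertexPattern q a ≡ true ⊎ vertexPattern q (suc a) ≡ true ⊎ vertexPattern q (suc (suc a)) ≡ true ⊎
  edgePattern q a ≡ true ⊎ edgePattern q (suc a) ≡ true
patterns-block zero    zero                = inj₂ (inj₂ (inj₂ (inj₂ refl)))
patterns-block zero    (suc zero)          = inj₂ (inj₂ (inj₂ (inj₁ refl)))
patterns-block zero    (suc (suc a))       = patterns-block zero a
patterns-block (suc q) zero                = inj₂ (inj₂ (inj₁ refl))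
patterns-block (suc q) (suc zero)          = inj₂ (inj₁ refl)
patterns-block (suc q) (suc (suc zero))    = inj₁ refl
patterns-block (suc q) (suc (suc (suc a))) = patterns-block q a

∑-vertexPattern : ∀ q m → 3 * q ≤ m → ∑ m (𝟙 ∘ vertexPattern q) ≡ q
∑-vertexPattern zero    m _ = ∑-zero m (λ _ _ → refl)
∑-vertexPattern (suc q) m 3+3q≤m rewrite *-suc 3 q with m | 3+3q≤m
... | suc (suc (suc m′)) | s≤s (s≤s (s≤s 3q≤m′)) = cong suc (∑-vertexPattern q m′ 3q≤m′)

∑-edgePattern : ∀ q m → ∑ m (𝟙 ∘ edgePattern q) ≡ (m ∸ 3 * q) / 2
∑-edgePattern zero    zero                 = refl
∑-edgePattern zero    (suc zero)           = refl
∑-edgePattern zero    (suc (suc m))        =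
  trans (cong suc (∑-edgePattern zero m)) (sym (m/n≡1+[m∸n]/n {suc (suc m)} {2} (s≤s (s≤s z≤n))))
∑-edgePattern (suc q) m rewrite *-suc 3 q with m
... | zero                = refl
... | suc zero            = refl
... | suc (suc zero)      = refl
... | suc (suc (suc m′))  = ∑-edgePattern q m′

patternEdges : ∀ {n} → ℕ → Fin n → Fin n → Bool
patternEdges {n} q x y = pathGraph n x y ∧ edgePattern q (toℕ x ⊓ toℕ y)

patternEdges-sym : ∀ {n} q (x y : Fin n) → patternEdges q x y ≡ patternEdges q y x
patternEdges-sym q x y =
  cong₂ _∧_ (pathGraph-sym x y) (cong (edgePattern q) (⊓-comm (toℕ x) (toℕ y)))

patternEdges-⊆ : ∀ {n} q (x y : Fin n) → patternEdges q x y ≡ true → pathGraph n x y ≡ true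
patternEdges-⊆ {n} q x y xy with pathGraph n x y
... | true = refl

patternEdges-consecutive : ∀ {n} q {u v : Fin n} → Consecutive u v →
                           patternEdges q u v ≡ edgePattern q (toℕ u)
patternEdges-consecutive q u→v =
  cong₂ _∧_ (consecutive⇒pathGraph u→v) (cong (edgePattern q) (consecutive-⊓ u→v))

edgeAt-fromℕ< : ∀ {n a} (E : Fin n → Fin n → Bool) (a<n : a < n) (1+a<n : suc a < n) →
                edgeAt E a ≡ E (fromℕ< a<n) (fromℕ< 1+a<n)
edgeAt-fromℕ< E a<n 1+a<n = trans (cong (edgeAt E) (sym (toℕ-fromℕ< a<n)))
                                   (edgeAt-consecutive E (fromℕ<-consecutive a<n 1+a<n))

edgeAt-last : ∀ {m} (E : Fin (suc m) → Fin (suc m) → Bool) → edgeAt E m ≡ false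
edgeAt-last {m} E = atℕ-false (λ x → atℕ-≥ (E x) ≤-refl) m

edgeCount-patternEdges : ∀ n q → edgeCount (patternEdges {n} q) ≡ (n ∸ 3 * q ∸ 1) / 2
edgeCount-patternEdges zero    q = cong (λ t → (t ∸ 1) / 2) (sym (0∸n≡0 (3 * q)))
edgeCount-patternEdges (suc m) q = begin
  edgeCount E                             ≡⟨ edgeCount≡∑edgeAt E (patternEdges-⊆ q) ⟩
  ∑ (suc m) (𝟙 ∘ edgeAt E)                ≡⟨ ∑-snoc m (𝟙 ∘ edgeAt E) ⟩
  ∑ m (𝟙 ∘ edgeAt E) + 𝟙 (edgeAt E m)     ≡⟨ cong₂ _+_ (∑-cong m inner) (cong 𝟙 (edgeAt-last E)) ⟩
  ∑ m (𝟙 ∘ edgePattern q) + 0             ≡⟨ +-identityʳ _ ⟩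
  ∑ m (𝟙 ∘ edgePattern q)                 ≡⟨ ∑-edgePattern q m ⟩
  (m ∸ 3 * q) / 2                         ≡⟨ cong (λ t → (suc m ∸ t) / 2) (+-comm (3 * q) 1) ⟨
  (suc m ∸ (3 * q + 1)) / 2               ≡⟨ cong (_/ 2) (∸-+-assoc (suc m) (3 * q) 1) ⟨
  (suc m ∸ 3 * q ∸ 1) / 2                 ∎
  where
  E : Fin (suc m) → Fin (suc m) → Bool
  E = patternEdges q
  inner : ∀ a → a < m → 𝟙 (edgeAt E a) ≡ 𝟙 (edgePattern q a)
  inner a a<m = cong 𝟙 (begin
    edgeAt E a
      ≡⟨ edgeAt-fromℕ< E a<1+m (s≤s a<m) ⟩
    E (fromℕ< a<1+m) (fromℕ< (s≤s a<m))
      ≡⟨ patternEdges-consecutive q (fromℕ<-consecutive a<1+m (s≤s a<m)) ⟩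
    edgePattern q (toℕ (fromℕ< a<1+m))
      ≡⟨ cong (edgePattern q) (toℕ-fromℕ< a<1+m) ⟩
    edgePattern q a
      ∎)
    where
    a<1+m : a < suc m
    a<1+m = m<n⇒m<1+n a<m

patternRemovalSet : ∀ {n j q} → q ≤ j → j ≤ n → 3 * q ≤ n →
  ∃ λ E → IsMixedRemovalSet (pathGraph n) j 1 E × edgeCount E ≡ (n ∸ 3 * q ∸ 1) / 2
patternRemovalSet {n} {j} {q} q≤j j≤n 3q≤n =
  patternEdges q ,
  ((patternEdges-sym q , patternEdges-⊆ q) , V , ∣V∣≡j ,
   matching⇒1-colourable (blocksAllP₃⇒matching {V = V} (patternEdges-sym q) blocks)) ,
  edgeCount-patternEdges n q
  where
  P : Subset n
  P = tabulateᵥ (vertexPattern q ∘ toℕ)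

  ∣P∣≡q : ∣ P ∣ ≡ q
  ∣P∣≡q = trans (∣tabulate∣≡∑ n (vertexPattern q)) (∑-vertexPattern q n 3q≤n)

  extension : ∃ λ V → P ⊆ V × ∣ V ∣ ≡ j
  extension = extendSubset P (subst (_≤ j) (sym ∣P∣≡q) q≤j) j≤n

  V : Subset n
  V = proj₁ extension

  ∣V∣≡j : ∣ V ∣ ≡ j
  ∣V∣≡j = proj₂ (proj₂ extension)

  P⊆V : ∀ x → vertexPattern q (toℕ x) ≡ true → lookup V x ≡ true
  P⊆V x px =
    []=⇒lookup (proj₁ (proj₂ extension) (lookup⇒[]= x P (trans (lookup∘tabulate _ x) px)))

  blocks : BlocksAllP₃ V (patternEdges q)
  blocks u v w u→v v→w =
    map⊎ (P⊆V u) (map⊎ (P⊆V v ∘ at v 1+u≡v) (map⊎ (P⊆V w ∘ at w 2+u≡w)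
      (map⊎ (trans (patternEdges-consecutive q u→v))
            (trans (patternEdges-consecutive q v→w) ∘ trans (cong (edgePattern q) u→v)))))
      (patterns-block q (toℕ u))
    where
    1+u≡v : suc (toℕ u) ≡ toℕ v
    1+u≡v = sym u→v
    2+u≡w : suc (suc (toℕ u)) ≡ toℕ w
    2+u≡w = sym (trans v→w (cong suc u→v))
    at : ∀ x {b} → b ≡ toℕ x → vertexPattern q b ≡ true → vertexPattern q (toℕ x) ≡ true
    at x b≡x = subst (λ b → vertexPattern q b ≡ true) b≡x

edgeCount-noEdges : ∀ n → edgeCount {n} (λ _ _ → false) ≡ 0
edgeCount-noEdges n = trans (edgeCount≡∑edgeAt {n} (λ _ _ → false) (λ _ _ ()))
  (∑-zero n (λ a _ → cong 𝟙 (atℕ-false {n} (λ _ → atℕ-false {n} (λ _ → refl) (suc a)) a)))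

zeroMixedIndex : ∀ {n} {G : Graph n} {j k E} → IsMixedRemovalSet G j k E → edgeCount E ≡ 0 →
                 MixedIndexIs G j k 0
zeroMixedIndex R ∣E∣≡0 = (_ , R , ∣E∣≡0) , λ _ _ → z≤n

removalSet-mono : ∀ {n} {G : Graph n} {j k k′ E} → k ≤ k′ →
                  IsMixedRemovalSet G j k E → IsMixedRemovalSet G j k′ E
removalSet-mono k≤k′ (E⊆G , V , ∣V∣≡j , colouring) =
  E⊆G , V , ∣V∣≡j , colouring-mono k≤k′ colouring

n≤3j+2⇒n/3≤j : ∀ {n} j → n ≤ 3 * j + 2 → n / 3 ≤ j
n≤3j+2⇒n/3≤j {n} j n≤ = s≤s⁻¹ (m<n*o⇒m/o<n (≤-trans (s≤s n≤) (≤-reflexive (reorder j))))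
  where
  reorder : ∀ j → suc (3 * j + 2) ≡ suc j * 3
  reorder = solve-∀

3*[n/3]≤n : ∀ n → 3 * (n / 3) ≤ n
3*[n/3]≤n n = subst (_≤ n) (*-comm (n / 3) 3) (m/n*n≤m n 3)

[n∸3*[n/3]∸1]/2≡0 : ∀ n → (n ∸ 3 * (n / 3) ∸ 1) / 2 ≡ 0
[n∸3*[n/3]∸1]/2≡0 n =
  m<n⇒m/n≡0 (subst (λ r → r ∸ 1 < 2) n%3≡ (s≤s (∸-monoˡ-≤ 1 (s≤s⁻¹ (m%n<n n 3)))))
  where
  n%3≡ : n % 3 ≡ n ∸ 3 * (n / 3)
  n%3≡ = trans (m%n≡m∸m/n*n n 3) (cong (n ∸_) (*-comm (n / 3) 3))

pathMixedIndex-manyColours : ∀ {n j k} → 2 ≤ k → j ≤ n → MixedIndexIs (pathGraph n) j k 0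
pathMixedIndex-manyColours {n} {j} {k} 2≤k j≤n
  with extendSubset ⊥ (≤-trans (≤-reflexive (∣⊥∣≡0 n)) z≤n) j≤n
... | V , _ , ∣V∣≡j =
  zeroMixedIndex (((λ _ _ → refl) , (λ _ _ ())) , V , ∣V∣≡j , colouring) (edgeCount-noEdges n)
  where
  colouring : ChromaticIndexAtMost (deleteMixed (pathGraph n) V (λ _ _ → false)) k
  colouring = colouring-mono 2≤k
    (colouring-⊆ (deleteMixed-⊆ (pathGraph n) V _) (pathGraph-2-colourable n))

pathMixedIndex-short : ∀ {n j k} → 1 ≤ k → j ≤ n → n ≤ 3 * j + 2 →
                       MixedIndexIs (pathGraph n) j k 0
pathMixedIndex-short {n} {j} 1≤k j≤n n≤3j+2
  with patternRemovalSet (n≤3j+2⇒n/3≤j j n≤3j+2) j≤n (3*[n/3]≤n n)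
... | E , R , ∣E∣≡ = zeroMixedIndex (removalSet-mono 1≤k R) (trans ∣E∣≡ ([n∸3*[n/3]∸1]/2≡0 n))

pathMixedIndex-long : ∀ {n j} → 3 * j + 3 ≤ n →
                      MixedIndexIs (pathGraph n) j 1 ((n ∸ 3 * j ∸ 1) / 2)
pathMixedIndex-long {n} {j} 3j+3≤n =
  patternRemovalSet ≤-refl (≤-trans (m≤m+n j (2 * j)) 3j≤n) 3j≤n , λ _ → removalSet-lowerBound
  where
  3j≤n : 3 * j ≤ n
  3j≤n = m+n≤o⇒m≤o (3 * j) 3j+3≤n

mainTheorem16 : (n k j : ℕ) → 1 ≤ k → j ≤ n / 2 →
    (((2 ≤ k ⊎ n ≤ 3 * j + 2) → MixedIndexIs (pathGraph n) j k 0) ×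
     ((k ≡ 1 × 3 * j + 3 ≤ n) →
        MixedIndexIs (pathGraph n) j k ((n ∸ 3 * j ∸ 1) / 2)))
mainTheorem16 n k j 1≤k j≤n/2 =
  [ (λ 2≤k → pathMixedIndex-manyColours 2≤k j≤n) , pathMixedIndex-short 1≤k j≤n ] ,
  λ (k≡1 , long) →
    subst (λ k → MixedIndexIs (pathGraph n) j k _) (sym k≡1) (pathMixedIndex-long long)
  where
  j≤n : j ≤ n
  j≤n = ≤-trans j≤n/2 (m/n≤m n 2)
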